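{- Let $\mathbb P$ be a class of non-empty partial orders and $\mathbb L$ a class of linear orders. Suppose that none of $2^{<\omega}$, $-2^{<\omega}$, $2^{<\omega}_\perp$ order-embeds into any member of $\mathbb P$. Then for every composition sequence $\eta$ and every $y\in\{2^{<\omega},-2^{<\omega},2^{<\omega}_\perp\}$, $y$ does not order-embed into $H_\eta$.
   Context: Order embedding: $a\le b\iff\varphi(a)\le\varphi(b)$. $2^{<\omega}$: finite $0$-$1$ sequences ordered by initial segment; $-2^{<\omega}$: its reverse; $2^{<\omega}_\perp$: finite $0$-$1$ sequences with $s<t$ iff $s=u^\frown0^\frown s'$ and $t=u^\frown1^\frown t'$ for some sequences $u,s',t'$. $\overline{\mathbb L}$: least class containing $\mathbb L$ and all finite linear orders, closed under $L$-sums for $L\in\overline{\mathbb L}$. A composition sequence is $\eta=\langle\langle P_i,s_i\rangle:i\in r\rangle$ with $r\in\overline{\mathbb L}$ (non-empty), $P_i\in\mathbb P$, $s_i\in P_i$. Put $a_i=P_i\setminus\{s_i\}$ if $i\ne\max r$ and $a_i=P_i$ if $i=\max r$. $H_\eta$ is $\bigsqcup_{i\in r}a_i$ with $u<v$ ($u\in a_i$, $v\in a_j$) iff $i=j$ and $u<_{P_i}v$; or $i<j$ and $u<_{P_i}s_i$; or $i>j$ and $v>_{P_j}s_j$. -}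

module Defs where

open import Level using (0ℓ)
open import Data.Bool using (Bool; true; false)
open import Data.List using (List; []; _∷_; _++_)
open import Data.Nat using (ℕ)
open import Data.Fin using (Fin) renaming (_≤_ to _≤ᶠ_)
open import Data.Product using (Σ; Σ-syntax; _×_; _,_)
open import Data.Sum using (_⊎_)
open import Relation.Nullary using (¬_)
open import Relation.Binary using (Rel; IsPartialOrder; IsTotalOrder)
open import Relation.Binary.PropositionalEquality using (_≡_; _≢_; subst)
open import Function.Definitions using (Bijective)

record PO : Set₁ where
  field
    Carrier        : Set
    _≤_            : Rel Carrier 0ℓ
    isPartialOrder : IsPartialOrder _≡_ _≤_
  _<_ : Rel Carrier 0ℓ
  x < y = x ≤ y × x ≢ y

record LO : Set₁ where
  field
    Carrier      : Set
    _≤_          : Rel Carrier 0ℓ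
    isTotalOrder : IsTotalOrder _≡_ _≤_
  _<_ : Rel Carrier 0ℓ
  x < y = x ≤ y × x ≢ y

Embeds : {A B : Set} → Rel A 0ℓ → Rel B 0ℓ → Set
Embeds {A} {B} R S =
  Σ[ φ ∈ (A → B) ] (∀ a b → (R a b → S (φ a) (φ b)) × (S (φ a) (φ b) → R a b))

OrderIso : {A B : Set} → Rel A 0ℓ → Rel B 0ℓ → Set
OrderIso {A} {B} R S =
  Σ[ φ ∈ (A → B) ] (Bijective _≡_ _≡_ φ ×
    (∀ a b → (R a b → S (φ a) (φ b)) × (S (φ a) (φ b) → R a b)))

LexSum : (I : LO) (F : LO.Carrier I → LO) →
         Rel (Σ[ i ∈ LO.Carrier I ] LO.Carrier (F i)) 0ℓ
LexSum I F (i , x) (j , y) =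
  LO._<_ I i j ⊎
  Σ[ p ∈ i ≡ j ] LO._≤_ (F j) (subst (λ k → LO.Carrier (F k)) p x) y

data Lbar (𝕃 : LO → Set) : LO → Set₁ where
  base   : ∀ {A} → 𝕃 A → Lbar 𝕃 A
  finite : ∀ {A} (n : ℕ) → OrderIso (LO._≤_ A) (_≤ᶠ_ {n}) → Lbar 𝕃 A
  sum    : ∀ {A} (I : LO) (F : LO.Carrier I → LO) →
           Lbar 𝕃 I → (∀ i → Lbar 𝕃 (F i)) →
           OrderIso (LO._≤_ A) (LexSum I F) → Lbar 𝕃 A

record CompSeq (𝕡 : PO → Set) (𝕃 : LO → Set) : Set₁ where
  field
    r          : LO
    r-nonempty : LO.Carrier r
    r-in       : Lbar 𝕃 r
    P          : LO.Carrier r → PO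
    P-in       : ∀ i → 𝕡 (P i)
    s          : ∀ i → PO.Carrier (P i)

module _ {𝕡 : PO → Set} {𝕃 : LO → Set} (η : CompSeq 𝕡 𝕃) where
  open CompSeq η

  IsMax : LO.Carrier r → Set
  IsMax i = ∀ j → LO._≤_ r j i

  InA : (i : LO.Carrier r) → PO.Carrier (P i) → Set
  InA i u = IsMax i ⊎ (u ≢ s i)

  HCarrier : Set
  HCarrier = Σ[ i ∈ LO.Carrier r ] Σ[ u ∈ PO.Carrier (P i) ] InA i u

  H< : Rel HCarrier 0ℓ
  H< (i , u , _) (j , v , _) =
    (Σ[ p ∈ i ≡ j ] PO._<_ (P j) (subst (λ k → PO.Carrier (P k)) p u) v)
    ⊎ (LO._<_ r i j × PO._<_ (P i) u (s i))
    ⊎ (LO._<_ r j i × PO._<_ (P j) (s j) v)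

  point : HCarrier → Σ[ i ∈ LO.Carrier r ] PO.Carrier (P i)
  point (i , u , _) = i , u

  H≤ : Rel HCarrier 0ℓ
  H≤ x y = point x ≡ point y ⊎ H< x y

data Test : Set where
  tree revtree perp : Test

Prefix : Rel (List Bool) 0ℓ
Prefix s t = Σ[ u ∈ List Bool ] s ++ u ≡ t

Split : Rel (List Bool) 0ℓ
Split s t = Σ[ u ∈ List Bool ] Σ[ s′ ∈ List Bool ] Σ[ t′ ∈ List Bool ]
  (s ≡ u ++ (false ∷ s′) × t ≡ u ++ (true ∷ t′))

testRel : Test → Rel (List Bool) 0ℓ
testRel tree    s t = Prefix s t
testRel revtree s t = Prefix t s
testRel perp    s t = s ≡ t ⊎ Split s t

-- If z lies in a block of H_η strictly below the blocks of x and y, then whether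
-- z < x (resp. x < z) only depends on the position of z relative to s in its own
-- factor, so z cannot tell x and y apart.  Each test order has a "fork": points
-- a = ⟨0⟩, b = ⟨1⟩ and self-embeddings w ↦ 00w, w ↦ 11w such that every point of
-- either branch separates a from b, while a and b each separate every point of
-- the first branch from every point of the second.  Under an embedding into H_η,
-- with a in a block not above that of b, every branch point therefore sits in a
-- block at or above that of a.  If some point of the first branch is strictly
-- above, a separates it from each point of the second branch, which is hence
-- contained in the block of a; otherwise the first branch is.  Either way a copy
-- of the test order lies in a single block, i.e. in some P_i.  Excluded middle
-- gives trichotomy of the index order and decides equality inside a block.

module Submission where

open import Defs
open import Level using (0ℓ)
open import Relation.Nullary using (¬_; yes; no)
open import Axiom.ExcludedMiddle using (ExcludedMiddle)
open import Data.Bool using (Bool; true; false)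
open import Data.List using ([]; _∷_; _++_)
open import Data.List.Properties using (++-assoc; ++-cancelˡ; ∷-injectiveʳ)
open import Data.Product using (Σ-syntax; ∃; _,_; proj₁; proj₂)
open import Data.Sum using (_⊎_; inj₁; inj₂; [_,_]′) renaming (map to ⊎-map)
open import Data.Empty using (⊥; ⊥-elim)
open import Function using (_∘_; id; flip; _⇔_; mk⇔; Equivalence)
open import Function.Properties.Equivalence using () renaming (sym to ⇔-sym; trans to ⇔-trans)
open import Relation.Binary using (Rel; IsPartialOrder; IsTotalOrder; Trichotomous; tri<; tri≈; tri>)
import Relation.Binary.Construct.NonStrictToStrict as ToStrict
open import Relation.Binary.PropositionalEquality using (_≡_; _≢_; refl; sym; trans; cong)

open Equivalence using (to; from)

module _ {A B : Set} (R : Rel A 0ℓ) (S : Rel B 0ℓ) where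

  embeds⇔ : (e : Embeds R S) → ∀ a b → R a b ⇔ S (proj₁ e a) (proj₁ e b)
  embeds⇔ (_ , e) a b = mk⇔ (proj₁ (e a b)) (proj₂ (e a b))

  embeds-flip : Embeds R S → Embeds (flip R) (flip S)
  embeds-flip (f , f-emb) = f , λ a b → f-emb b a

embeds-trans : {A B C : Set} (R : Rel A 0ℓ) (S : Rel B 0ℓ) (T : Rel C 0ℓ) →
  Embeds R S → Embeds S T → Embeds R T
embeds-trans _ _ _ (f , f-emb) (g , g-emb) =
  g ∘ f , λ a b → proj₁ (g-emb _ _) ∘ proj₁ (f-emb a b) , proj₂ (f-emb a b) ∘ proj₂ (g-emb _ _)

record Indiscernible {A : Set} (R : Rel A 0ℓ) (x a b : A) : Set where
  constructor indiscernible
  field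
    below : R a x ⇔ R b x
    above : R x a ⇔ R x b

Separates : {A : Set} → Rel A 0ℓ → A → A → A → Set
Separates R x a b = ¬ Indiscernible R x a b

module _ {A : Set} {R : Rel A 0ℓ} {x a b : A} where

  separates-below : R a x → ¬ R b x → Separates R x a b
  separates-below Rax ¬Rbx (indiscernible below _) = ¬Rbx (to below Rax)

  separates-above : R x a → ¬ R x b → Separates R x a b
  separates-above Rxa ¬Rxb (indiscernible _ above) = ¬Rxb (to above Rxa)

  separates-sym : Separates R x a b → Separates R x b a
  separates-sym sep (indiscernible below above) = sep (indiscernible (⇔-sym below) (⇔-sym above))

  separates-flip : Separates R x a b → Separates (flip R) x a b
  separates-flip sep (indiscernible below above) = sep (indiscernible above below)

indiscernible-pullback : {A B : Set} {R : Rel A 0ℓ} {S : Rel B 0ℓ} (e : Embeds R S) →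
  ∀ {x a b} → Indiscernible S (proj₁ e x) (proj₁ e a) (proj₁ e b) → Indiscernible R x a b
indiscernible-pullback {R = R} {S = S} e {x} {a} {b} (indiscernible below above) = indiscernible
    (⇔-trans (embeds⇔ R S e a x) (⇔-trans below (⇔-sym (embeds⇔ R S e b x))))
    (⇔-trans (embeds⇔ R S e x a) (⇔-trans above (⇔-sym (embeds⇔ R S e x b))))

record Fork {A : Set} (R : Rel A 0ℓ) : Set where
  field
    left right        : A
    branchˡ branchʳ   : Embeds R R
    branchˡ-separates : ∀ w → Separates R (proj₁ branchˡ w) left right
    branchʳ-separates : ∀ w → Separates R (proj₁ branchʳ w) left right
    left-separates    : ∀ w w′ → Separates R left (proj₁ branchˡ w) (proj₁ branchʳ w′)
    right-separates   : ∀ w w′ → Separates R right (proj₁ branchˡ w) (proj₁ branchʳ w′)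

  swap : Fork R
  swap = record
    { left = right ; right = left ; branchˡ = branchʳ ; branchʳ = branchˡ
    ; branchˡ-separates = separates-sym ∘ branchʳ-separates
    ; branchʳ-separates = separates-sym ∘ branchˡ-separates
    ; left-separates    = λ w w′ → separates-sym (right-separates w′ w)
    ; right-separates   = λ w w′ → separates-sym (left-separates w′ w)
    }

  reverse : Fork (flip R)
  reverse = record
    { left = left ; right = right
    ; branchˡ = embeds-flip R R branchˡ ; branchʳ = embeds-flip R R branchʳ
    ; branchˡ-separates = separates-flip ∘ branchˡ-separates
    ; branchʳ-separates = separates-flip ∘ branchʳ-separates
    ; left-separates    = λ w w′ → separates-flip (left-separates w w′)
    ; right-separates   = λ w w′ → separates-flip (right-separates w w′)
    }

module _ (em : ExcludedMiddle 0ℓ) {𝕡 : PO → Set} {𝕃 : LO → Set} (η : CompSeq 𝕡 𝕃) where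
  open CompSeq η
  open LO r using () renaming (Carrier to Index; _≤_ to _≤ʳ_; _<_ to _<ʳ_)
  private
    module Order = IsTotalOrder (LO.isTotalOrder r)
    module Strict = ToStrict _≡_ _≤ʳ_

  <ʳ-trichotomous : Trichotomous _≡_ _<ʳ_
  <ʳ-trichotomous = Strict.<-trichotomous sym (λ _ _ → em) Order.antisym Order.total

  block : HCarrier η → Index
  block = proj₁

  element : (x : HCarrier η) → PO.Carrier (P (block x))
  element = proj₁ ∘ proj₂

  H≤-from-higher-block : ∀ {x z} → block z <ʳ block x → H≤ η x z →
                         PO._<_ (P (block z)) (s (block z)) (element z)
  H≤-from-higher-block z<x (inj₁ x≡z) =
    ⊥-elim (Strict.<-irrefl (sym (cong proj₁ x≡z)) z<x)
  H≤-from-higher-block z<x (inj₂ (inj₁ (x≡z , _))) =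
    ⊥-elim (Strict.<-irrefl (sym x≡z) z<x)
  H≤-from-higher-block z<x (inj₂ (inj₂ (inj₁ (x<z , _)))) =
    ⊥-elim (Strict.<-asym Order.antisym x<z z<x)
  H≤-from-higher-block z<x (inj₂ (inj₂ (inj₂ (_ , s<z)))) = s<z

  H≤-to-higher-block : ∀ {x z} → block z <ʳ block x → H≤ η z x →
                       PO._<_ (P (block z)) (element z) (s (block z))
  H≤-to-higher-block z<x (inj₁ z≡x) =
    ⊥-elim (Strict.<-irrefl (cong proj₁ z≡x) z<x)
  H≤-to-higher-block z<x (inj₂ (inj₁ (z≡x , _))) =
    ⊥-elim (Strict.<-irrefl z≡x z<x)
  H≤-to-higher-block z<x (inj₂ (inj₂ (inj₁ (_ , z<s)))) = z<s
  H≤-to-higher-block z<x (inj₂ (inj₂ (inj₂ (x<z , _)))) =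
    ⊥-elim (Strict.<-asym Order.antisym x<z z<x)

  indiscernible-from-lower-block : ∀ {x y z} → block z <ʳ block x → block z <ʳ block y →
                             Indiscernible (H≤ η) z x y
  indiscernible-from-lower-block {x} {y} {z} z<x z<y = indiscernible
    (mk⇔ (λ h → inj₂ (inj₂ (inj₂ (z<y , H≤-from-higher-block {x} {z} z<x h))))
         (λ h → inj₂ (inj₂ (inj₂ (z<x , H≤-from-higher-block {y} {z} z<y h)))))
    (mk⇔ (λ h → inj₂ (inj₂ (inj₁ (z<y , H≤-to-higher-block {x} {z} z<x h))))
         (λ h → inj₂ (inj₂ (inj₁ (z<x , H≤-to-higher-block {y} {z} z<y h)))))

  H≤-in-block : ∀ {j u v} (u∈a : InA η j u) (v∈a : InA η j v) →
                H≤ η (j , u , u∈a) (j , v , v∈a) ⇔ PO._≤_ (P j) u v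
  H≤-in-block {j} {u} {v} u∈a v∈a = mk⇔ to-block from-block
    where
      module Pj = IsPartialOrder (PO.isPartialOrder (P j))
      to-block : H≤ η (j , u , u∈a) (j , v , v∈a) → PO._≤_ (P j) u v
      to-block (inj₁ refl)                          = Pj.refl
      to-block (inj₂ (inj₁ (refl , u≤v , _)))       = u≤v
      to-block (inj₂ (inj₂ (inj₁ ((_ , j≢j) , _)))) = ⊥-elim (j≢j refl)
      to-block (inj₂ (inj₂ (inj₂ ((_ , j≢j) , _)))) = ⊥-elim (j≢j refl)
      from-block : PO._≤_ (P j) u v → H≤ η (j , u , u∈a) (j , v , v∈a)
      from-block u≤v with em {u ≡ v}
      ... | yes refl = inj₁ refl
      ... | no u≢v   = inj₂ (inj₁ (refl , u≤v , u≢v))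

  relocate : ∀ {j} (x : HCarrier η) → block x ≡ j → PO.Carrier (P j)
  relocate (_ , u , _) refl = u

  H≤-within-block : ∀ {j} x y (x∈j : block x ≡ j) (y∈j : block y ≡ j) →
                    H≤ η x y ⇔ PO._≤_ (P j) (relocate x x∈j) (relocate y y∈j)
  H≤-within-block (_ , _ , u∈a) (_ , _ , v∈a) refl refl = H≤-in-block u∈a v∈a

  embeds-within-block : ∀ {A : Set} {R : Rel A 0ℓ} {j} (φ : Embeds R (H≤ η)) →
                        (∀ w → block (proj₁ φ w) ≡ j) → Embeds R (PO._≤_ (P j))
  embeds-within-block {R = R} φ φ∈j = (λ w → relocate (proj₁ φ w) (φ∈j w)) , λ a b →
    let R⇔P = ⇔-trans (embeds⇔ R (H≤ η) φ a b) (H≤-within-block _ _ (φ∈j a) (φ∈j b))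
    in to R⇔P , from R⇔P

  module _ {A : Set} {R : Rel A 0ℓ} (φ : Embeds R (H≤ η)) where

    block-of : A → Index
    block-of = block ∘ proj₁ φ

    separator-not-below : ∀ {x a b} → Separates R x a b →
                          block-of x <ʳ block-of a → block-of x <ʳ block-of b → ⊥
    separator-not-below sep x<a x<b =
      sep (indiscernible-pullback φ (indiscernible-from-lower-block x<a x<b))

    separator-at-or-above : ∀ {x a b} → block-of a ≤ʳ block-of b → Separates R x a b →
                            block-of a <ʳ block-of x ⊎ block-of x ≡ block-of a
    separator-at-or-above {x} {a} a≤b sep with <ʳ-trichotomous (block-of a) (block-of x)
    ... | tri< a<x _ _ = inj₁ a<x
    ... | tri≈ _ a≡x _ = inj₂ (sym a≡x)
    ... | tri> _ _ x<a = ⊥-elim (separator-not-below sep x<a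
                           (Strict.<-≤-trans sym Order.trans Order.antisym Order.≤-respʳ-≈ x<a a≤b))

    branch-within-block : ∀ {j} → Σ[ e ∈ Embeds R R ] (∀ w → block-of (proj₁ e w) ≡ j) →
                          Embeds R (PO._≤_ (P j))
    branch-within-block (e , e∈j) = embeds-within-block (embeds-trans R R (H≤ η) e φ) e∈j

    module _ (F : Fork R) where
      open Fork F

      fork-branch-within-left-block : block-of left ≤ʳ block-of right →
                                      Σ[ e ∈ Embeds R R ] ∀ w → block-of (proj₁ e w) ≡ block-of left
      fork-branch-within-left-block l≤r
        with em {∃ λ w → block-of left <ʳ block-of (proj₁ branchˡ w)}
      ... | no ¬above = branchˡ , λ w →
        [ (λ above → ⊥-elim (¬above (w , above))) , id ]′
          (separator-at-or-above l≤r (branchˡ-separates w))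
      ... | yes (w , above) = branchʳ , λ w′ →
        [ (λ above′ → ⊥-elim (separator-not-below (left-separates w w′) above above′)) , id ]′
          (separator-at-or-above l≤r (branchʳ-separates w′))

    fork-embeds-within-block : Fork R → Σ[ j ∈ Index ] Embeds R (PO._≤_ (P j))
    fork-embeds-within-block F
      with Order.total (block-of (Fork.left F)) (block-of (Fork.right F))
    ... | inj₁ l≤r = _ , branch-within-block (fork-branch-within-left-block F l≤r)
    ... | inj₂ r≤l = _ , branch-within-block (fork-branch-within-left-block (Fork.swap F) r≤l)

prefix-cons : ∀ c {s t} → Prefix (c ∷ s) (c ∷ t) ⇔ Prefix s t
prefix-cons c = mk⇔ (λ (u , eq) → u , ∷-injectiveʳ eq) (λ (u , eq) → u , cong (c ∷_) eq)

split-cons : ∀ c {s t} → Split (c ∷ s) (c ∷ t) ⇔ Split s t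
split-cons c =
  mk⇔ drop (λ (u , s′ , t′ , eqₛ , eqₜ) → c ∷ u , s′ , t′ , cong (c ∷_) eqₛ , cong (c ∷_) eqₜ)
  where
  drop : ∀ {s t} → Split (c ∷ s) (c ∷ t) → Split s t
  drop ([] , _ , _ , refl , ())
  drop (_ ∷ u , s′ , t′ , eqₛ , eqₜ) = u , s′ , t′ , ∷-injectiveʳ eqₛ , ∷-injectiveʳ eqₜ

cons-embeds : ∀ y (c : Bool) → Embeds (testRel y) (testRel y)
cons-embeds tree    c = c ∷_ , λ _ _ → from (prefix-cons c) , to (prefix-cons c)
cons-embeds revtree c = embeds-flip Prefix Prefix (cons-embeds tree c)
cons-embeds perp    c = c ∷_ , λ _ _ →
  ⊎-map (cong (c ∷_)) (from (split-cons c)) , ⊎-map ∷-injectiveʳ (to (split-cons c))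

twice-cons-embeds : ∀ y (c : Bool) → Embeds (testRel y) (testRel y)
twice-cons-embeds y c =
  embeds-trans (testRel y) (testRel y) (testRel y) (cons-embeds y c) (cons-embeds y c)

++-false≢++-true : ∀ u {s t} → u ++ false ∷ s ≢ u ++ true ∷ t
++-false≢++-true u eq with ++-cancelˡ u _ _ eq
... | ()

prefix⇒¬split : ∀ {s t} → Prefix s t → ¬ Split s t
prefix⇒¬split (v , refl) (u , s′ , _ , refl , eq) =
  ++-false≢++-true u (trans (sym (++-assoc u (false ∷ s′) v)) eq)

prefix⇒¬split˘ : ∀ {s t} → Prefix t s → ¬ Split s t
prefix⇒¬split˘ (v , refl) (u , _ , t′ , eq , refl) =
  ++-false≢++-true u (trans (sym eq) (++-assoc u (true ∷ t′) v))

comparable⇒¬perp : ∀ {s t} → Prefix s t ⊎ Prefix t s → s ≢ t → ¬ testRel perp s t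
comparable⇒¬perp s≶t s≢t = [ s≢t , [ prefix⇒¬split , prefix⇒¬split˘ ]′ s≶t ]′

prefix-fork : Fork (testRel tree)
prefix-fork = record
  { left = false ∷ [] ; right = true ∷ []
  ; branchˡ = twice-cons-embeds tree false ; branchʳ = twice-cons-embeds tree true
  ; branchˡ-separates = λ w → separates-below (false ∷ w , refl) λ { (_ , ()) }
  ; branchʳ-separates = λ w → separates-sym (separates-below (true ∷ w , refl) λ { (_ , ()) })
  ; left-separates    = λ w _ → separates-above (false ∷ w , refl) λ { (_ , ()) }
  ; right-separates   = λ _ w′ → separates-sym (separates-above (true ∷ w′ , refl) λ { (_ , ()) })
  }

perp-fork : Fork (testRel perp)
perp-fork = record
  { left = false ∷ [] ; right = true ∷ []
  ; branchˡ = twice-cons-embeds perp false ; branchʳ = twice-cons-embeds perp true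
  ; branchˡ-separates = λ w → separates-sym (separates-above
      (inj₂ ([] , false ∷ w , [] , refl , refl))
      (comparable⇒¬perp (inj₂ (false ∷ w , refl)) λ ()))
  ; branchʳ-separates = λ w → separates-below
      (inj₂ ([] , [] , true ∷ w , refl , refl))
      (comparable⇒¬perp (inj₁ (true ∷ w , refl)) λ ())
  ; left-separates    = λ w w′ → separates-sym (separates-above
      (inj₂ ([] , [] , true ∷ w′ , refl , refl))
      (comparable⇒¬perp (inj₁ (false ∷ w , refl)) λ ()))
  ; right-separates   = λ w w′ → separates-below
      (inj₂ ([] , false ∷ w , [] , refl , refl))
      (comparable⇒¬perp (inj₂ (true ∷ w′ , refl)) λ ())
  }

test-fork : ∀ y → Fork (testRel y)
test-fork tree    = prefix-fork
test-fork revtree = Fork.reverse prefix-fork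
test-fork perp    = perp-fork

lemma7p26 : ExcludedMiddle 0ℓ →
    (𝕡 : PO → Set) (𝕃 : LO → Set) →
    (∀ Q → 𝕡 Q → PO.Carrier Q) →
    (∀ Q → 𝕡 Q → ∀ y → ¬ Embeds (testRel y) (PO._≤_ Q)) →
    (η : CompSeq 𝕡 𝕃) → ∀ y → ¬ Embeds (testRel y) (H≤ η)
lemma7p26 em _ _ _ no-test-in-𝕡 η y φ =
  let (j , ψ) = fork-embeds-within-block em η φ (test-fork y)
  in no-test-in-𝕡 (CompSeq.P η j) (CompSeq.P-in η j) y ψ
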